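{- Let $P \in Y_n$ be a standard Young tableau. Consider a path $\emptyset = P_0 \to P_1 \to \cdots \to P_n = P$ in which, for each $j$, $P_j = \mathrm{ins}_{k_j}(P_{j-1})$ for some $k_j \in \{1,\dots,j\}$, and assign it the weight $\prod_{j=1}^n q^{\,j-k_j}$. Let $Q$ be the standard Young tableau of the same shape as $P$ whose entry $j$ lies in the cell $\mathrm{sh}(P_j) \setminus \mathrm{sh}(P_{j-1})$. Then the weight of the path equals $q^{\mathrm{inv}(w)}$, where $w$ is the permutation corresponding to the pair $(P,Q)$ under the Robinson–Schensted bijection.
   Context: $Y_m$ denotes the set of standard Young tableaux of size $m$, and $\emptyset$ the empty tableau. For $P \in Y_{m}$ and $k \in \{1,\dots,m+1\}$, $\mathrm{ins}_k(P) \in Y_{m+1}$ is obtained by increasing every entry of $P$ that is $\geq k$ by $1$ and then Schensted row-inserting $k$. $\mathrm{sh}(\cdot)$ denotes the shape of a tableau. $\mathrm{inv}(w)$ is the number of inversions of $w$, i.e. pairs $i<j$ with $w(i)>w(j)$. The Robinson–Schensted bijection sends a permutation to its (insertion tableau, recording tableau) pair. -}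

module Defs where

open import Data.Nat using (ℕ; zero; suc; _≤_; _∸_; _^_; _*_; _<ᵇ_; _≤ᵇ_)
open import Data.Bool using (Bool; true; false; if_then_else_)
open import Data.List using (List; []; _∷_; map; length; filter; upTo; _++_)
open import Data.Maybe using (Maybe; just; nothing)
open import Data.Product using (_×_; _,_)
open import Data.Unit using (⊤)
open import Data.Nat using (_<?_; _≟_; _+_)
open import Relation.Nullary using (yes; no)
open import Relation.Binary.PropositionalEquality using (_≡_)
open import Data.List.Relation.Binary.Permutation.Propositional using (_↭_)

-- A (Young) tableau is a list of rows (top row first), each row a list of entries.
Tableau : Set
Tableau = List (List ℕ)

sh : Tableau → List ℕ
sh = map length

rowIns : ℕ → List ℕ → Maybe ℕ × List ℕ
rowIns x [] = nothing , x ∷ []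
rowIns x (y ∷ ys) with x <ᵇ y
... | true  = just y , x ∷ ys
... | false with rowIns x ys
...   | b , r = b , y ∷ r

schIns : ℕ → Tableau → Tableau
schIns x [] = (x ∷ []) ∷ []
schIns x (r ∷ rs) with rowIns x r
... | nothing , r' = r' ∷ rs
... | just y  , r' = r' ∷ schIns y rs

ins : ℕ → Tableau → Tableau
ins k P = schIns k (map (map (λ e → if k ≤ᵇ e then suc e else e)) P)

-- Index (0-based) of the row of the unique cell of  new \ old  for shapes
-- old ⊂ new differing in one cell: the first row whose length differs
-- (or the index of the new row if new has one more row).
addedRow : List ℕ → List ℕ → ℕ
addedRow []       _        = 0
addedRow (_ ∷ _)  []       = 0
addedRow (a ∷ as) (b ∷ bs) with a ≟ b
... | yes _ = suc (addedRow as bs)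
... | no _  = 0

addAt : ℕ → ℕ → Tableau → Tableau
addAt _       j []       = (j ∷ []) ∷ []
addAt zero    j (r ∷ rs) = (r ++ (j ∷ [])) ∷ rs
addAt (suc i) j (r ∷ rs) = r ∷ addAt i j rs

grow : ℕ → Tableau → Tableau → Tableau → Tableau
grow j old new Q = addAt (addedRow (sh new) (sh old)) j Q

-- Robinson–Schensted: a permutation in one-line notation w(1) … w(n)
-- is sent to (insertion tableau, recording tableau).
rsGo : ℕ → List ℕ → Tableau × Tableau → Tableau × Tableau
rsGo j []       (P , Q) = P , Q
rsGo j (x ∷ xs) (P , Q) = rsGo (suc j) xs (schIns x P , grow j P (schIns x P) Q)

RS : List ℕ → Tableau × Tableau
RS w = rsGo 1 w ([] , [])

pathGo : ℕ → List ℕ → Tableau × Tableau → Tableau × Tableau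
pathGo j []       (P , Q) = P , Q
pathGo j (k ∷ ks) (P , Q) = pathGo (suc j) ks (ins k P , grow j P (ins k P) Q)

path : List ℕ → Tableau × Tableau
path ks = pathGo 1 ks ([] , [])

-- Validity of the step labels: kⱼ ∈ {1, …, j}, where the head of the list is step j.
ValidSteps : ℕ → List ℕ → Set
ValidSteps j []       = ⊤
ValidSteps j (k ∷ ks) = (1 ≤ k) × (k ≤ j) × ValidSteps (suc j) ks

weightGo : ℕ → ℕ → List ℕ → ℕ
weightGo q j []       = 1
weightGo q j (k ∷ ks) = q ^ (j ∸ k) * weightGo q (suc j) ks

weight : ℕ → List ℕ → ℕ
weight q ks = weightGo q 1 ks

inv : List ℕ → ℕ
inv []       = 0
inv (x ∷ xs) = length (filter (λ y → y <? x) xs) + inv xs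

IsPerm : ℕ → List ℕ → Set
IsPerm n w = w ↭ map suc (upTo n)

-- Induct on n, peeling off the last letter x = w(n) and the last step k = kₙ.
-- Both Robinson–Schensted and ins_k end with a Schensted insertion, and
-- Schensted insertion into a tableau of known shape is inverted by reverse
-- bumping from the new cell, which Q records.  Since Schensted insertion
-- commutes with strictly monotone relabellings, this forces x to be the image
-- of k and the RS pair of w(1) … w(n−1) to be (a relabelling of Pₙ₋₁, Qₙ₋₁),
-- so the claim has to be proved for relabelled paths.  The new inversions
-- created by x are then the entries of Pₙ₋₁ that ins_k shifts, i.e. those
-- ≥ k, and there are n − k of them because Pₙ₋₁ has entries 1, …, n − 1.
module Submission where

open import Defs
open import Data.Nat using (ℕ; _^_)
open import Data.List using (List; length)
open import Data.Product using (_,_)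
open import Relation.Binary.PropositionalEquality using (_≡_)

open import Data.Bool using (Bool; true; false; T; if_then_else_)
open import Data.Empty using (⊥-elim)
open import Data.List
  using ([]; _∷_; _∷ʳ_; _++_; map; filter; concat; upTo; initLast; _∷ʳ′_; unsnoc)
open import Data.List.Properties
  using (map-id; map-cong; map-∘; length-map; length-++; ++-identityʳ; concat-map;
         length-upTo; ∷-injective; filter-all; filter-reject; filter-++)
open import Data.List.Relation.Unary.All as All using (All; []; _∷_)
import Data.List.Relation.Unary.All.Properties as All
open import Data.List.Relation.Unary.AllPairs as AllPairs using (AllPairs; []; _∷_)
import Data.List.Relation.Unary.AllPairs.Properties as AllPairs
open import Data.List.Relation.Binary.Permutation.Propositional.Properties using (↭-length)
open import Data.List.Reverse using (Reverse; []; _∶_∶ʳ_; reverseView)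
open import Data.Maybe as Maybe using (Maybe; just; nothing)
open import Data.Nat
  using (zero; suc; _+_; _*_; _∸_; _≤_; _<_; z≤n; s≤s; s≤s⁻¹; _<ᵇ_; _≤ᵇ_; _<?_; _≤?_; _≟_)
open import Data.Nat.Properties
open import Algebra.Properties.CommutativeSemigroup +-commutativeSemigroup
  using (interchange; x∙yz≈y∙xz)
open import Data.Product as Prod using (_×_; proj₁; proj₂)
open import Data.Sum using (inj₁; inj₂)
open import Data.Unit using (tt)
open import Function using (_∘_; id; mk⇔)
open import Relation.Binary.Core using (_Preserves_⟶_)
open import Relation.Binary.PropositionalEquality
  using (refl; sym; trans; cong; cong₂; subst; module ≡-Reasoning)
open import Relation.Nullary using (does; yes; no)
open import Relation.Nullary.Decidable using (dec-true; dec-false; does-⇔)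
open import Relation.Unary using (Pred; Decidable)

<⇒<ᵇ≡true : ∀ {m n} → m < n → (m <ᵇ n) ≡ true
<⇒<ᵇ≡true {m} {n} = dec-true (m <? n)

≥⇒<ᵇ≡false : ∀ {m n} → n ≤ m → (m <ᵇ n) ≡ false
≥⇒<ᵇ≡false {m} {n} n≤m = dec-false (m <? n) (≤⇒≯ n≤m)

≤⇒≤ᵇ≡true : ∀ {m n} → m ≤ n → (m ≤ᵇ n) ≡ true
≤⇒≤ᵇ≡true {m} {n} = dec-true (m ≤? n)

>⇒≤ᵇ≡false : ∀ {m n} → n < m → (m ≤ᵇ n) ≡ false
>⇒≤ᵇ≡false {m} {n} n<m = dec-false (m ≤? n) (<⇒≱ n<m)

<ᵇ≡true⇒< : ∀ {m n} → (m <ᵇ n) ≡ true → m < n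
<ᵇ≡true⇒< {m} {n} eq = <ᵇ⇒< m n (subst T (sym eq) tt)

<ᵇ≡false⇒≥ : ∀ {m n} → (m <ᵇ n) ≡ false → n ≤ m
<ᵇ≡false⇒≥ eq = ≮⇒≥ (λ m<n → subst T eq (<⇒<ᵇ m<n))

-- Strictly monotone relabellings and the shift performed by ins

StrictlyMonotone : (ℕ → ℕ) → Set
StrictlyMonotone f = f Preserves _<_ ⟶ _<_

strictMono⇒mono : ∀ {f} → StrictlyMonotone f → f Preserves _≤_ ⟶ _≤_
strictMono⇒mono f-mono a≤b with m≤n⇒m<n∨m≡n a≤b
... | inj₁ a<b  = <⇒≤ (f-mono a<b)
... | inj₂ refl = ≤-refl

strictMono-<ᵇ : ∀ {f} → StrictlyMonotone f → ∀ a b → (f a <ᵇ f b) ≡ (a <ᵇ b)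
strictMono-<ᵇ {f} f-mono a b = does-⇔ (mk⇔ reflect f-mono) (f a <? f b) (a <? b)
  where
  reflect : f a < f b → a < b
  reflect fa<fb = ≰⇒> (λ b≤a → <⇒≱ fa<fb (strictMono⇒mono f-mono b≤a))

-- By definition, ins k P = schIns k (relabel (shift k) P).
shift : ℕ → ℕ → ℕ
shift k e = if k ≤ᵇ e then suc e else e

shift-< : ∀ {k e} → e < k → shift k e ≡ e
shift-< {k} {e} e<k rewrite >⇒≤ᵇ≡false {k} {e} e<k = refl

shift-≥ : ∀ {k e} → k ≤ e → shift k e ≡ suc e
shift-≥ {k} {e} k≤e rewrite ≤⇒≤ᵇ≡true k≤e = refl

shift-strictMono : ∀ k → StrictlyMonotone (shift k)
shift-strictMono k {a} {b} a<b with k ≤? a | k ≤? b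
... | yes k≤a | yes k≤b rewrite shift-≥ k≤a | shift-≥ k≤b = s≤s a<b
... | yes k≤a | no k≰b  = ⊥-elim (k≰b (≤-trans k≤a (<⇒≤ a<b)))
... | no k≰a  | yes k≤b rewrite shift-< (≰⇒> k≰a) | shift-≥ k≤b = m<n⇒m<1+n a<b
... | no k≰a  | no k≰b  rewrite shift-< (≰⇒> k≰a) | shift-< (≰⇒> k≰b) = a<b

<ᵇ-shift : ∀ k e → (k <ᵇ shift k e) ≡ (k ≤ᵇ e)
<ᵇ-shift k e with k ≤? e
... | yes k≤e rewrite shift-≥ k≤e | ≤⇒≤ᵇ≡true k≤e = <⇒<ᵇ≡true (s≤s k≤e)
... | no k≰e  rewrite shift-< (≰⇒> k≰e) | >⇒≤ᵇ≡false (≰⇒> k≰e) =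
  ≥⇒<ᵇ≡false (<⇒≤ (≰⇒> k≰e))

≤ᵇ-shift-≤ : ∀ {i k} → i ≤ k → ∀ e → (i ≤ᵇ shift k e) ≡ (i ≤ᵇ e)
≤ᵇ-shift-≤ {i} {k} i≤k e with k ≤? e
... | yes k≤e rewrite shift-≥ k≤e =
  does-⇔ (mk⇔ (λ _ → ≤-trans i≤k k≤e) m≤n⇒m≤1+n) (i ≤? suc e) (i ≤? e)
... | no k≰e rewrite shift-< (≰⇒> k≰e) = refl

≤ᵇ-shift-≥ : ∀ {i k} → k ≤ i → ∀ e → (suc i ≤ᵇ shift k e) ≡ (i ≤ᵇ e)
≤ᵇ-shift-≥ {i} {k} k≤i e with k ≤? e
... | yes k≤e rewrite shift-≥ k≤e = does-⇔ (mk⇔ s≤s⁻¹ s≤s) (suc i ≤? suc e) (i ≤? e)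
... | no k≰e rewrite shift-< (≰⇒> k≰e) =
  does-⇔ (mk⇔ (λ 1+i≤e → ⊥-elim (k≰e (≤-trans k≤i (≤-trans (n≤1+n i) 1+i≤e))))
                (λ i≤e → ⊥-elim (k≰e (≤-trans k≤i i≤e))))
         (suc i ≤? e) (i ≤? e)

toℕ : Bool → ℕ
toℕ false = 0
toℕ true  = 1

count : (ℕ → Bool) → List ℕ → ℕ
count p []       = 0
count p (x ∷ xs) = toℕ (p x) + count p xs

count-++ : ∀ p xs ys → count p (xs ++ ys) ≡ count p xs + count p ys
count-++ p []       ys = refl
count-++ p (x ∷ xs) ys rewrite count-++ p xs ys = sym (+-assoc (toℕ (p x)) _ _)

count-∷ʳ : ∀ p xs x → count p (xs ∷ʳ x) ≡ toℕ (p x) + count p xs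
count-∷ʳ p xs x = begin
  count p (xs ∷ʳ x)             ≡⟨ count-++ p xs (x ∷ []) ⟩
  count p xs + (toℕ (p x) + 0)  ≡⟨ cong (count p xs +_) (+-identityʳ _) ⟩
  count p xs + toℕ (p x)        ≡⟨ +-comm (count p xs) _ ⟩
  toℕ (p x) + count p xs        ∎
  where open ≡-Reasoning

count-map : ∀ p g xs → count p (map g xs) ≡ count (p ∘ g) xs
count-map p g []       = refl
count-map p g (x ∷ xs) = cong (toℕ (p (g x)) +_) (count-map p g xs)

count-cong : ∀ {p p′} → (∀ e → p e ≡ p′ e) → ∀ xs → count p xs ≡ count p′ xs
count-cong p≗p′ []       = refl
count-cong p≗p′ (x ∷ xs) = cong₂ _+_ (cong toℕ (p≗p′ x)) (count-cong p≗p′ xs)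

length-filter≡count : ∀ {ℓ} {P : Pred ℕ ℓ} (P? : Decidable P) xs →
                      length (filter P? xs) ≡ count (does ∘ P?) xs
length-filter≡count P? []       = refl
length-filter≡count P? (x ∷ xs) with does (P? x)
... | true  = cong suc (length-filter≡count P? xs)
... | false = length-filter≡count P? xs

inv-∷ʳ : ∀ xs x → inv (xs ∷ʳ x) ≡ inv xs + count (x <ᵇ_) xs
inv-∷ʳ []       x = refl
inv-∷ʳ (y ∷ ys) x = begin
  length (filter (_<? y) (ys ∷ʳ x)) + inv (ys ∷ʳ x)
    ≡⟨ cong₂ _+_ (trans (length-filter≡count (_<? y) (ys ∷ʳ x)) (count-∷ʳ (_<ᵇ y) ys x))
                 (inv-∷ʳ ys x) ⟩
  (toℕ (x <ᵇ y) + count (_<ᵇ y) ys) + (inv ys + count (x <ᵇ_) ys)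
    ≡⟨ cong (_+ (inv ys + count (x <ᵇ_) ys)) (+-comm (toℕ (x <ᵇ y)) _) ⟩
  (count (_<ᵇ y) ys + toℕ (x <ᵇ y)) + (inv ys + count (x <ᵇ_) ys)
    ≡⟨ interchange (count (_<ᵇ y) ys) _ _ _ ⟩
  (count (_<ᵇ y) ys + inv ys) + (toℕ (x <ᵇ y) + count (x <ᵇ_) ys)
    ≡⟨ cong (_+ count (x <ᵇ_) (y ∷ ys)) (cong (_+ inv ys) (sym (length-filter≡count (_<? y) ys))) ⟩
  inv (y ∷ ys) + count (x <ᵇ_) (y ∷ ys)
    ∎
  where open ≡-Reasoning

-- Row insertion

Sorted : List ℕ → Set
Sorted = AllPairs _≤_

length-∷ʳ : ∀ (xs : List ℕ) x → length (xs ∷ʳ x) ≡ suc (length xs)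
length-∷ʳ xs x = trans (length-++ xs) (+-comm (length xs) 1)

rowIns-map : ∀ {f} → StrictlyMonotone f → ∀ x r →
             rowIns (f x) (map f r) ≡ Prod.map (Maybe.map f) (map f) (rowIns x r)
rowIns-map f-mono x [] = refl
rowIns-map f-mono x (y ∷ ys) rewrite strictMono-<ᵇ f-mono x y with x <ᵇ y
... | true = refl
... | false rewrite rowIns-map f-mono x ys with rowIns x ys
...   | b , r = refl

rowIns-appends : ∀ x r {r′} → rowIns x r ≡ (nothing , r′) → r′ ≡ r ∷ʳ x
rowIns-appends x [] refl = refl
rowIns-appends x (y ∷ ys) eq with x <ᵇ y
... | true with eq
...   | ()
rowIns-appends x (y ∷ ys) eq | false with rowIns x ys in e
... | b , r with eq
...   | refl = cong (y ∷_) (rowIns-appends x ys e)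

rowIns-bump-length : ∀ x r {b r′} → rowIns x r ≡ (just b , r′) → length r′ ≡ length r
rowIns-bump-length x [] ()
rowIns-bump-length x (y ∷ ys) eq with x <ᵇ y
... | true with eq
...   | refl = refl
rowIns-bump-length x (y ∷ ys) eq | false with rowIns x ys in e
... | b , r with eq
...   | refl = cong suc (rowIns-bump-length x ys e)

count-rowIns-bump : ∀ p x r {b r′} → rowIns x r ≡ (just b , r′) →
                    toℕ (p b) + count p r′ ≡ toℕ (p x) + count p r
count-rowIns-bump p x [] ()
count-rowIns-bump p x (y ∷ ys) eq with x <ᵇ y
... | true with eq
...   | refl = x∙yz≈y∙xz (toℕ (p y)) (toℕ (p x)) (count p ys)
count-rowIns-bump p x (y ∷ ys) eq | false with rowIns x ys in e
... | nothing , r with eq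
...   | ()
count-rowIns-bump p x (y ∷ ys) eq | false | just b , r with eq
...   | refl = begin
  toℕ (p b) + (toℕ (p y) + count p r)   ≡⟨ x∙yz≈y∙xz (toℕ (p b)) (toℕ (p y)) _ ⟩
  toℕ (p y) + (toℕ (p b) + count p r)   ≡⟨ cong (toℕ (p y) +_) (count-rowIns-bump p x ys e) ⟩
  toℕ (p y) + (toℕ (p x) + count p ys)  ≡⟨ x∙yz≈y∙xz (toℕ (p y)) (toℕ (p x)) _ ⟩
  toℕ (p x) + (toℕ (p y) + count p ys)  ∎
  where open ≡-Reasoning

rowIns-All : ∀ {ℓ} {P : Pred ℕ ℓ} x r → All P r → P x → All P (proj₂ (rowIns x r))
rowIns-All x [] [] px = px ∷ []
rowIns-All x (y ∷ ys) (py ∷ pys) px with x <ᵇ y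
... | true = px ∷ pys
... | false with rowIns x ys | rowIns-All x ys pys px
...   | _ , r | pr = py ∷ pr

rowIns-sorted : ∀ x r → Sorted r → Sorted (proj₂ (rowIns x r))
rowIns-sorted x [] [] = [] ∷ []
rowIns-sorted x (y ∷ ys) (y≤ys ∷ sorted) with x <ᵇ y in x<ᵇy
... | true = All.map (≤-trans (<⇒≤ (<ᵇ≡true⇒< x<ᵇy))) y≤ys ∷ sorted
... | false with rowIns x ys | rowIns-All x ys y≤ys (<ᵇ≡false⇒≥ x<ᵇy) | rowIns-sorted x ys sorted
...   | _ , r | y≤r | sorted-r = y≤r ∷ sorted-r

rowIns-nonEmpty : ∀ x r → 0 < length (proj₂ (rowIns x r))
rowIns-nonEmpty x [] = s≤s z≤n
rowIns-nonEmpty x (y ∷ ys) with x <ᵇ y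
... | true = s≤s z≤n
... | false with rowIns x ys
...   | _ , r = s≤s z≤n

-- Reverse bumping: b replaces the rightmost entry smaller than b, which is returned.
unRowIns : ℕ → List ℕ → Maybe (ℕ × List ℕ)
unRowIns b [] = nothing
unRowIns b (y ∷ ys) with unRowIns b ys
... | just (z , ys′) = just (z , y ∷ ys′)
... | nothing        = if y <ᵇ b then just (y , b ∷ ys) else nothing

unRowIns-none : ∀ b r → All (b ≤_) r → unRowIns b r ≡ nothing
unRowIns-none b [] [] = refl
unRowIns-none b (y ∷ ys) (b≤y ∷ b≤ys) rewrite unRowIns-none b ys b≤ys | ≥⇒<ᵇ≡false b≤y = refl

unRowIns-rowIns : ∀ x r {b r′} → Sorted r → rowIns x r ≡ (just b , r′) →
                  unRowIns b r′ ≡ just (x , r)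
unRowIns-rowIns x [] _ ()
unRowIns-rowIns x (y ∷ ys) (y≤ys ∷ _) eq with x <ᵇ y in x<ᵇy
... | true with eq
...   | refl rewrite unRowIns-none y ys y≤ys | x<ᵇy = refl
unRowIns-rowIns x (y ∷ ys) (_ ∷ sorted) eq | false with rowIns x ys in e
... | _ , r with eq
...   | refl rewrite unRowIns-rowIns x ys sorted e = refl

-- Tableaux and Schensted insertion

RowsSorted : Tableau → Set
RowsSorted = All Sorted

NonEmptyRows : Tableau → Set
NonEmptyRows = All (λ r → 0 < length r)

relabel : (ℕ → ℕ) → Tableau → Tableau
relabel f = map (map f)

relabel-id : ∀ T → relabel id T ≡ T
relabel-id T = trans (map-cong map-id T) (map-id T)

relabel-∘ : ∀ f g T → relabel (f ∘ g) T ≡ relabel f (relabel g T)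
relabel-∘ f g T = trans (map-cong map-∘ T) (map-∘ T)

sh-relabel : ∀ f T → sh (relabel f T) ≡ sh T
sh-relabel f T = trans (sym (map-∘ T)) (map-cong (length-map f) T)

count-concat-relabel : ∀ p f T → count p (concat (relabel f T)) ≡ count (p ∘ f) (concat T)
count-concat-relabel p f T = trans (cong (count p) (concat-map T)) (count-map p f (concat T))

relabel-rowsSorted : ∀ {f} → f Preserves _≤_ ⟶ _≤_ →
                     ∀ {T} → RowsSorted T → RowsSorted (relabel f T)
relabel-rowsSorted f-mono sorted =
  All.map⁺ (All.map (λ s → AllPairs.map⁺ (AllPairs.map f-mono s)) sorted)

relabel-nonEmptyRows : ∀ f {T} → NonEmptyRows T → NonEmptyRows (relabel f T)
relabel-nonEmptyRows f nonEmpty =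
  All.map⁺ (All.map (λ {r} 0<r → subst (0 <_) (sym (length-map f r)) 0<r) nonEmpty)

nonEmptyRows-sh : ∀ Q T → sh Q ≡ sh T → NonEmptyRows T → NonEmptyRows Q
nonEmptyRows-sh []       _        _  _                   = []
nonEmptyRows-sh (_ ∷ _)  []       ()
nonEmptyRows-sh (q ∷ qs) (r ∷ rs) eq (0<r ∷ nonEmpty) with ∷-injective eq
... | |q|≡|r| , eqs = subst (0 <_) (sym |q|≡|r|) 0<r ∷ nonEmptyRows-sh qs rs eqs nonEmpty

schIns-relabel : ∀ {f} → StrictlyMonotone f → ∀ x T →
                 schIns (f x) (relabel f T) ≡ relabel f (schIns x T)
schIns-relabel f-mono x [] = refl
schIns-relabel f-mono x (r ∷ rs) rewrite rowIns-map f-mono x r with rowIns x r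
... | nothing , r′ = refl
... | just y  , r′ = cong (_ ∷_) (schIns-relabel f-mono y rs)

insertionRow : ℕ → Tableau → ℕ
insertionRow x [] = 0
insertionRow x (r ∷ rs) with rowIns x r
... | nothing , _ = 0
... | just y  , _ = suc (insertionRow y rs)

addedRow-schIns : ∀ x T → addedRow (sh (schIns x T)) (sh T) ≡ insertionRow x T
addedRow-schIns x [] = refl
addedRow-schIns x (r ∷ rs) with rowIns x r in eq
... | nothing , r′ with length r′ ≟ length r
...   | yes |r′|≡|r| = ⊥-elim (1+n≢n (begin
          suc (length r)   ≡⟨ sym (length-∷ʳ r x) ⟩
          length (r ∷ʳ x)  ≡⟨ cong length (sym (rowIns-appends x r eq)) ⟩
          length r′        ≡⟨ |r′|≡|r| ⟩
          length r         ∎))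
  where open ≡-Reasoning
...   | no _ = refl
addedRow-schIns x (r ∷ rs) | just y , r′ with length r′ ≟ length r
... | yes _        = cong suc (addedRow-schIns y rs)
... | no |r′|≢|r| = ⊥-elim (|r′|≢|r| (rowIns-bump-length x r eq))

schIns-rowsSorted : ∀ x T → RowsSorted T → RowsSorted (schIns x T)
schIns-rowsSorted x [] [] = ([] ∷ []) ∷ []
schIns-rowsSorted x (r ∷ rs) (sorted ∷ sorteds) with rowIns x r | rowIns-sorted x r sorted
... | nothing , _ | sorted′ = sorted′ ∷ sorteds
... | just y  , _ | sorted′ = sorted′ ∷ schIns-rowsSorted y rs sorteds

schIns-nonEmptyRows : ∀ x T → NonEmptyRows T → NonEmptyRows (schIns x T)
schIns-nonEmptyRows x [] [] = s≤s z≤n ∷ []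
schIns-nonEmptyRows x (r ∷ rs) (_ ∷ nonEmpty) with rowIns x r | rowIns-nonEmpty x r
... | nothing , _ | 0<r′ = 0<r′ ∷ nonEmpty
... | just y  , _ | 0<r′ = 0<r′ ∷ schIns-nonEmptyRows y rs nonEmpty

count-schIns : ∀ p x T → count p (concat (schIns x T)) ≡ toℕ (p x) + count p (concat T)
count-schIns p x [] = refl
count-schIns p x (r ∷ rs) with rowIns x r in eq
... | nothing , r′ rewrite rowIns-appends x r eq = begin
  count p (r ∷ʳ x ++ rest)                 ≡⟨ count-++ p (r ∷ʳ x) rest ⟩
  count p (r ∷ʳ x) + count p rest          ≡⟨ cong (_+ count p rest) (count-∷ʳ p r x) ⟩
  toℕ (p x) + count p r + count p rest     ≡⟨ +-assoc (toℕ (p x)) _ _ ⟩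
  toℕ (p x) + (count p r + count p rest)   ≡⟨ cong (toℕ (p x) +_) (sym (count-++ p r rest)) ⟩
  toℕ (p x) + count p (r ++ rest)          ∎
  where
  open ≡-Reasoning
  rest = concat rs
... | just y , r′ = begin
  count p (r′ ++ concat (schIns y rs))     ≡⟨ count-++ p r′ _ ⟩
  count p r′ + count p (concat (schIns y rs))
    ≡⟨ cong (count p r′ +_) (count-schIns p y rs) ⟩
  count p r′ + (toℕ (p y) + count p rest)  ≡⟨ x∙yz≈y∙xz (count p r′) (toℕ (p y)) _ ⟩
  toℕ (p y) + (count p r′ + count p rest)  ≡⟨ sym (+-assoc (toℕ (p y)) _ _) ⟩
  toℕ (p y) + count p r′ + count p rest    ≡⟨ cong (_+ count p rest) (count-rowIns-bump p x r eq) ⟩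
  toℕ (p x) + count p r + count p rest     ≡⟨ +-assoc (toℕ (p x)) _ _ ⟩
  toℕ (p x) + (count p r + count p rest)   ≡⟨ cong (toℕ (p x) +_) (sym (count-++ p r rest)) ⟩
  toℕ (p x) + count p (r ++ rest)          ∎
  where
  open ≡-Reasoning
  rest = concat rs

consNonEmpty : List ℕ → Tableau → Tableau
consNonEmpty []       rs = rs
consNonEmpty (y ∷ ys) rs = (y ∷ ys) ∷ rs

initLast-∷ʳ : ∀ (xs : List ℕ) x → initLast (xs ∷ʳ x) ≡ xs ∷ʳ′ x
initLast-∷ʳ []       x = refl
initLast-∷ʳ (y ∷ ys) x rewrite initLast-∷ʳ ys x = refl

unsnoc-∷ʳ : ∀ (xs : List ℕ) x → unsnoc (xs ∷ʳ x) ≡ just (xs , x)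
unsnoc-∷ʳ xs x rewrite initLast-∷ʳ xs x = refl

-- Removes the cell at the end of row d and reverse-bumps its entry to the top.
-- Off the image of schIns the result (0 , []) is junk.
unSchIns : ℕ → Tableau → ℕ × Tableau
unSchIns zero [] = 0 , []
unSchIns zero (r ∷ rs) with unsnoc r
... | just (r₀ , x) = x , consNonEmpty r₀ rs
... | nothing       = 0 , []
unSchIns (suc d) [] = 0 , []
unSchIns (suc d) (r ∷ rs) with unSchIns d rs
... | y , rs′ with unRowIns y r
...   | just (x , r₀) = x , r₀ ∷ rs′
...   | nothing       = 0 , []

unSchIns-schIns : ∀ x T → RowsSorted T → NonEmptyRows T →
                  unSchIns (insertionRow x T) (schIns x T) ≡ (x , T)
unSchIns-schIns x [] _ _ = refl
unSchIns-schIns x ([] ∷ rs) _ (() ∷ _)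
unSchIns-schIns x ((y ∷ ys) ∷ rs) (sorted ∷ sorteds) (_ ∷ nonEmpty) with rowIns x (y ∷ ys) in eq
... | nothing , r′ rewrite rowIns-appends x (y ∷ ys) eq | unsnoc-∷ʳ (y ∷ ys) x = refl
... | just b  , r′ rewrite unSchIns-schIns b rs sorteds nonEmpty
                         | unRowIns-rowIns x (y ∷ ys) sorted eq = refl

schIns-injective : ∀ {x y T U} → RowsSorted T → NonEmptyRows T → RowsSorted U → NonEmptyRows U →
                   sh T ≡ sh U → schIns x T ≡ schIns y U → x ≡ y × T ≡ U
schIns-injective {x} {y} {T} {U} sortedT nonEmptyT sortedU nonEmptyU shT≡shU eq =
  cong proj₁ xT≡yU , cong proj₂ xT≡yU
  where
  open ≡-Reasoning
  sameRow : insertionRow x T ≡ insertionRow y U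
  sameRow = begin
    insertionRow x T                    ≡⟨ sym (addedRow-schIns x T) ⟩
    addedRow (sh (schIns x T)) (sh T)   ≡⟨ cong₂ addedRow (cong sh eq) shT≡shU ⟩
    addedRow (sh (schIns y U)) (sh U)   ≡⟨ addedRow-schIns y U ⟩
    insertionRow y U                    ∎
  xT≡yU : (x , T) ≡ (y , U)
  xT≡yU = begin
    (x , T)                                  ≡⟨ sym (unSchIns-schIns x T sortedT nonEmptyT) ⟩
    unSchIns (insertionRow x T) (schIns x T) ≡⟨ cong₂ unSchIns sameRow eq ⟩
    unSchIns (insertionRow y U) (schIns y U) ≡⟨ unSchIns-schIns y U sortedU nonEmptyU ⟩
    (y , U)                                  ∎

-- Recording tableaux

Bounded : ℕ → Tableau → Set
Bounded n = All (All (_< n))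

sh-addAt : ∀ x j T Q → sh Q ≡ sh T → sh (addAt (insertionRow x T) j Q) ≡ sh (schIns x T)
sh-addAt x j []       []       eq = refl
sh-addAt x j []       (_ ∷ _)  ()
sh-addAt x j (r ∷ rs) []       ()
sh-addAt x j (r ∷ rs) (q ∷ qs) eq with ∷-injective eq | rowIns x r in ins-eq
... | |q|≡|r| , eqs | nothing , r′ = cong₂ _∷_ |q∷ʳj|≡|r′| eqs
  where
  open ≡-Reasoning
  |q∷ʳj|≡|r′| : length (q ∷ʳ j) ≡ length r′
  |q∷ʳj|≡|r′| = begin
    length (q ∷ʳ j)  ≡⟨ length-∷ʳ q j ⟩
    suc (length q)   ≡⟨ cong suc |q|≡|r| ⟩
    suc (length r)   ≡⟨ sym (length-∷ʳ r x) ⟩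
    length (r ∷ʳ x)  ≡⟨ cong length (sym (rowIns-appends x r ins-eq)) ⟩
    length r′        ∎
... | |q|≡|r| , eqs | just y , r′ =
  cong₂ _∷_ (trans |q|≡|r| (sym (rowIns-bump-length x r ins-eq))) (sh-addAt y j rs qs eqs)

addAt-bounded : ∀ d j Q → Bounded j Q → Bounded (suc j) (addAt d j Q)
addAt-bounded d       j []       []       = (≤-refl ∷ []) ∷ []
addAt-bounded zero    j (r ∷ rs) (b ∷ bs) =
  All.++⁺ (All.map m<n⇒m<1+n b) (≤-refl ∷ []) ∷ All.map (All.map m<n⇒m<1+n) bs
addAt-bounded (suc d) j (r ∷ rs) (b ∷ bs) = All.map m<n⇒m<1+n b ∷ addAt-bounded d j rs bs

restrictBelow : ℕ → Tableau → Tableau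
restrictBelow n []       = []
restrictBelow n (r ∷ rs) = consNonEmpty (filter (_<? n) r) (restrictBelow n rs)

filter-<-∷ʳ : ∀ n r → All (_< n) r → filter (_<? n) (r ∷ʳ n) ≡ r
filter-<-∷ʳ n r r<n = begin
  filter (_<? n) (r ∷ʳ n)                       ≡⟨ filter-++ (_<? n) r (n ∷ []) ⟩
  filter (_<? n) r ++ filter (_<? n) (n ∷ [])
    ≡⟨ cong₂ _++_ (filter-all (_<? n) r<n) (filter-reject (_<? n) (n≮n n)) ⟩
  r ++ []                                       ≡⟨ ++-identityʳ r ⟩
  r                                             ∎
  where open ≡-Reasoning

restrictBelow-id : ∀ n Q → Bounded n Q → NonEmptyRows Q → restrictBelow n Q ≡ Q
restrictBelow-id n [] [] [] = refl
restrictBelow-id n ([] ∷ rs) _ (() ∷ _)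
restrictBelow-id n ((y ∷ ys) ∷ rs) (b ∷ bs) (_ ∷ nonEmpty)
  rewrite filter-all (_<? n) b | restrictBelow-id n rs bs nonEmpty = refl

restrictBelow-addAt : ∀ d n Q → Bounded n Q → NonEmptyRows Q → restrictBelow n (addAt d n Q) ≡ Q
restrictBelow-addAt d n [] [] [] rewrite filter-reject (_<? n) {xs = []} (n≮n n) = refl
restrictBelow-addAt d n ([] ∷ rs) _ (() ∷ _)
restrictBelow-addAt zero n ((y ∷ ys) ∷ rs) (b ∷ bs) (_ ∷ nonEmpty)
  rewrite filter-<-∷ʳ n (y ∷ ys) b | restrictBelow-id n rs bs nonEmpty = refl
restrictBelow-addAt (suc d) n ((y ∷ ys) ∷ rs) (b ∷ bs) (_ ∷ nonEmpty)
  rewrite filter-all (_<? n) b | restrictBelow-addAt d n rs bs nonEmpty = refl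

addAt-cancel : ∀ {d d′ n Q Q′} → Bounded n Q → NonEmptyRows Q →
               Bounded n Q′ → NonEmptyRows Q′ →
               addAt d n Q ≡ addAt d′ n Q′ → Q ≡ Q′
addAt-cancel {d} {d′} {n} {Q} {Q′} bQ neQ bQ′ neQ′ eq = begin
  Q                             ≡⟨ sym (restrictBelow-addAt d n Q bQ neQ) ⟩
  restrictBelow n (addAt d n Q) ≡⟨ cong (restrictBelow n) eq ⟩
  restrictBelow n (addAt d′ n Q′) ≡⟨ restrictBelow-addAt d′ n Q′ bQ′ neQ′ ⟩
  Q′                            ∎
  where open ≡-Reasoning

record Coherent (j : ℕ) (PQ : Tableau × Tableau) : Set where
  field
    sorted    : RowsSorted (proj₁ PQ)
    nonEmpty  : NonEmptyRows (proj₁ PQ)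
    sameShape : sh (proj₂ PQ) ≡ sh (proj₁ PQ)
    bounded   : Bounded j (proj₂ PQ)

open Coherent

rsStep : ℕ → ℕ → Tableau × Tableau → Tableau × Tableau
rsStep j x PQ = schIns x (proj₁ PQ) , grow j (proj₁ PQ) (schIns x (proj₁ PQ)) (proj₂ PQ)

pathStep : ℕ → ℕ → Tableau × Tableau → Tableau × Tableau
pathStep j k PQ = ins k (proj₁ PQ) , grow j (proj₁ PQ) (ins k (proj₁ PQ)) (proj₂ PQ)

coherent-rsStep : ∀ {j} x PQ → Coherent j PQ → Coherent (suc j) (rsStep j x PQ)
coherent-rsStep {j} x (P , Q) c = record
  { sorted    = schIns-rowsSorted x P (sorted c)
  ; nonEmpty  = schIns-nonEmptyRows x P (nonEmpty c)
  ; sameShape = subst (λ d → sh (addAt d j Q) ≡ sh (schIns x P)) (sym (addedRow-schIns x P))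
                      (sh-addAt x j P Q (sameShape c))
  ; bounded   = addAt-bounded _ j Q (bounded c)
  }

coherent-relabel : ∀ {f j P Q} → f Preserves _≤_ ⟶ _≤_ →
                   Coherent j (P , Q) → Coherent j (relabel f P , Q)
coherent-relabel {f} {P = P} f-mono c = record
  { sorted    = relabel-rowsSorted f-mono (sorted c)
  ; nonEmpty  = relabel-nonEmptyRows f (nonEmpty c)
  ; sameShape = trans (sameShape c) (sym (sh-relabel f P))
  ; bounded   = bounded c
  }

coherent-pathStep : ∀ {j} k PQ → Coherent j PQ → Coherent (suc j) (pathStep j k PQ)
coherent-pathStep {j} k (P , Q) c =
  subst (λ s → Coherent (suc j) (ins k P , addAt (addedRow (sh (ins k P)) s) j Q))
        (sh-relabel (shift k) P)
        (coherent-rsStep k _ (coherent-relabel (strictMono⇒mono (shift-strictMono k)) c))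

coherent-empty : Coherent 1 ([] , [])
coherent-empty = record { sorted = [] ; nonEmpty = [] ; sameShape = refl ; bounded = [] }

-- The entries are 1, …, m, recorded by how many of them are ≥ i.
ContentUpTo : ℕ → Tableau → Set
ContentUpTo m P = ∀ i → 1 ≤ i → i ≤ suc m → count (i ≤ᵇ_) (concat P) ≡ suc m ∸ i

contentUpTo-empty : ContentUpTo 0 []
contentUpTo-empty (suc zero) _ _ = refl
contentUpTo-empty (suc (suc _)) _ (s≤s ())

contentUpTo-ins : ∀ {m k P} → ContentUpTo m P → 1 ≤ k → k ≤ suc m → ContentUpTo (suc m) (ins k P)
contentUpTo-ins {m} {k} {P} content 1≤k k≤1+m i 1≤i i≤2+m
  rewrite count-schIns (i ≤ᵇ_) k (relabel (shift k) P)
        | count-concat-relabel (i ≤ᵇ_) (shift k) P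
  with i ≤? k
... | yes i≤k rewrite ≤⇒≤ᵇ≡true i≤k | count-cong (≤ᵇ-shift-≤ i≤k) (concat P)
                    | content i 1≤i (≤-trans i≤k k≤1+m) = sym (+-∸-assoc 1 (≤-trans i≤k k≤1+m))
contentUpTo-ins {m} {k} {P} content 1≤k k≤1+m (suc i) _ (s≤s i≤1+m) | no i≰k
  rewrite >⇒≤ᵇ≡false (≰⇒> i≰k) | count-cong (≤ᵇ-shift-≥ (s≤s⁻¹ (≰⇒> i≰k))) (concat P) =
  content i (≤-trans 1≤k (s≤s⁻¹ (≰⇒> i≰k))) i≤1+m

rsGo-∷ʳ : ∀ j xs x PQ → rsGo j (xs ∷ʳ x) PQ ≡ rsStep (j + length xs) x (rsGo j xs PQ)
rsGo-∷ʳ j []       x PQ rewrite +-identityʳ j = refl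
rsGo-∷ʳ j (y ∷ xs) x PQ rewrite +-suc j (length xs) = rsGo-∷ʳ (suc j) xs x _

pathGo-∷ʳ : ∀ j ks k PQ → pathGo j (ks ∷ʳ k) PQ ≡ pathStep (j + length ks) k (pathGo j ks PQ)
pathGo-∷ʳ j []       k PQ rewrite +-identityʳ j = refl
pathGo-∷ʳ j (k′ ∷ ks) k PQ rewrite +-suc j (length ks) = pathGo-∷ʳ (suc j) ks k _

RS-∷ʳ : ∀ w x → RS (w ∷ʳ x) ≡ rsStep (suc (length w)) x (RS w)
RS-∷ʳ w x = rsGo-∷ʳ 1 w x ([] , [])

path-∷ʳ : ∀ ks k → path (ks ∷ʳ k) ≡ pathStep (suc (length ks)) k (path ks)
path-∷ʳ ks k = pathGo-∷ʳ 1 ks k ([] , [])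

validSteps-∷ʳ : ∀ j ks k → ValidSteps j (ks ∷ʳ k) → ValidSteps j ks × 1 ≤ k × k ≤ j + length ks
validSteps-∷ʳ j []        k (1≤k , k≤j , _) rewrite +-identityʳ j = tt , 1≤k , k≤j
validSteps-∷ʳ j (k′ ∷ ks) k (1≤k′ , k′≤j , valid) with validSteps-∷ʳ (suc j) ks k valid
... | valid′ , 1≤k , k≤ =
  (1≤k′ , k′≤j , valid′) , 1≤k , subst (k ≤_) (sym (+-suc j (length ks))) k≤

weightGo-∷ʳ : ∀ q j ks k → weightGo q j (ks ∷ʳ k) ≡ weightGo q j ks * q ^ (j + length ks ∸ k)
weightGo-∷ʳ q j []        k rewrite +-identityʳ j = trans (*-identityʳ _) (sym (*-identityˡ _))
weightGo-∷ʳ q j (k′ ∷ ks) k rewrite weightGo-∷ʳ q (suc j) ks k | +-suc j (length ks) =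
  sym (*-assoc (q ^ (j ∸ k′)) _ _)

coherent-RS : ∀ {w} → Reverse w → Coherent (suc (length w)) (RS w)
coherent-RS [] = coherent-empty
coherent-RS (w ∶ rw ∶ʳ x) rewrite RS-∷ʳ w x | length-∷ʳ w x = coherent-rsStep x (RS w) (coherent-RS rw)

count-RS : ∀ p {w} → Reverse w → count p (concat (proj₁ (RS w))) ≡ count p w
count-RS p [] = refl
count-RS p (w ∶ rw ∶ʳ x) rewrite RS-∷ʳ w x | count-schIns p x (proj₁ (RS w)) | count-RS p rw =
  sym (count-∷ʳ p w x)

coherent-path : ∀ {ks} → Reverse ks → Coherent (suc (length ks)) (path ks)
coherent-path [] = coherent-empty
coherent-path (ks ∶ rks ∶ʳ k) rewrite path-∷ʳ ks k | length-∷ʳ ks k =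
  coherent-pathStep k (path ks) (coherent-path rks)

contentUpTo-path : ∀ {ks} → Reverse ks → ValidSteps 1 ks → ContentUpTo (length ks) (proj₁ (path ks))
contentUpTo-path [] _ = contentUpTo-empty
contentUpTo-path (ks ∶ rks ∶ʳ k) valid rewrite path-∷ʳ ks k | length-∷ʳ ks k
  with validSteps-∷ʳ 1 ks k valid
... | valid′ , 1≤k , k≤ = contentUpTo-ins {P = proj₁ (path ks)} (contentUpTo-path rks valid′) 1≤k k≤

-- The last step of a relabelled path

RS≡path-∷ʳ : ∀ {f k x} ks w → length ks ≡ length w →
  RS (w ∷ʳ x) ≡ (relabel f (proj₁ (path (ks ∷ʳ k))) , proj₂ (path (ks ∷ʳ k))) →
  rsStep (suc (length ks)) x (RS w) ≡
  (relabel f (ins k (proj₁ (path ks))) , proj₂ (pathStep (suc (length ks)) k (path ks)))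
RS≡path-∷ʳ {f} {k} {x} ks w len eq = begin
  rsStep (suc (length ks)) x (RS w)  ≡⟨ cong (λ j → rsStep (suc j) x (RS w)) len ⟩
  rsStep (suc (length w)) x (RS w)   ≡⟨ sym (RS-∷ʳ w x) ⟩
  RS (w ∷ʳ x)                        ≡⟨ eq ⟩
  (relabel f (proj₁ (path (ks ∷ʳ k))) , proj₂ (path (ks ∷ʳ k)))
    ≡⟨ cong (λ PQ → relabel f (proj₁ PQ) , proj₂ PQ) (path-∷ʳ ks k) ⟩
  (relabel f (ins k (proj₁ (path ks))) , proj₂ (pathStep (suc (length ks)) k (path ks))) ∎
  where open ≡-Reasoning

lastStep-determined : ∀ {f j x k PQR PQ} → StrictlyMonotone f → Coherent j PQR → Coherent j PQ →
  rsStep j x PQR ≡ (relabel f (ins k (proj₁ PQ)) , grow j (proj₁ PQ) (ins k (proj₁ PQ)) (proj₂ PQ)) →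
  x ≡ f k × proj₁ PQR ≡ relabel (f ∘ shift k) (proj₁ PQ) × proj₂ PQR ≡ proj₂ PQ
lastStep-determined {f} {j} {x} {k} {PR , QR} {P , Q} f-mono cR c eq =
  proj₁ inverted , proj₂ inverted , QR≡Q
  where
  open ≡-Reasoning
  g-mono : (f ∘ shift k) Preserves _≤_ ⟶ _≤_
  g-mono = strictMono⇒mono (f-mono ∘ shift-strictMono k)
  cT : Coherent j (relabel (f ∘ shift k) P , Q)
  cT = coherent-relabel g-mono c
  insertions : schIns x PR ≡ schIns (f k) (relabel (f ∘ shift k) P)
  insertions = begin
    schIns x PR
      ≡⟨ cong proj₁ eq ⟩
    relabel f (schIns k (relabel (shift k) P))
      ≡⟨ sym (schIns-relabel f-mono k (relabel (shift k) P)) ⟩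
    schIns (f k) (relabel f (relabel (shift k) P))
      ≡⟨ cong (schIns (f k)) (sym (relabel-∘ f (shift k) P)) ⟩
    schIns (f k) (relabel (f ∘ shift k) P)
      ∎
  QR≡Q : QR ≡ Q
  QR≡Q = addAt-cancel (bounded cR) (nonEmptyRows-sh QR PR (sameShape cR) (nonEmpty cR))
                      (bounded c) (nonEmptyRows-sh Q P (sameShape c) (nonEmpty c)) (cong proj₂ eq)
  sameShape′ : sh PR ≡ sh (relabel (f ∘ shift k) P)
  sameShape′ = begin
    sh PR                         ≡⟨ sym (sameShape cR) ⟩
    sh QR                         ≡⟨ cong sh QR≡Q ⟩
    sh Q                          ≡⟨ sameShape cT ⟩
    sh (relabel (f ∘ shift k) P)  ∎
  inverted : x ≡ f k × PR ≡ relabel (f ∘ shift k) P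
  inverted = schIns-injective (sorted cR) (nonEmpty cR) (sorted cT) (nonEmpty cT) sameShape′ insertions

inversions-lastLetter : ∀ {f m k P w} → StrictlyMonotone f → ContentUpTo m P → 1 ≤ k → k ≤ suc m →
  Reverse w → proj₁ (RS w) ≡ relabel (f ∘ shift k) P → count (f k <ᵇ_) w ≡ suc m ∸ k
inversions-lastLetter {f} {m} {k} {P} {w} f-mono content 1≤k k≤1+m rw PR≡ = begin
  count (f k <ᵇ_) w
    ≡⟨ sym (count-RS (f k <ᵇ_) rw) ⟩
  count (f k <ᵇ_) (concat (proj₁ (RS w)))
    ≡⟨ cong (count (f k <ᵇ_) ∘ concat) PR≡ ⟩
  count (f k <ᵇ_) (concat (relabel (f ∘ shift k) P))
    ≡⟨ count-concat-relabel (f k <ᵇ_) (f ∘ shift k) P ⟩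
  count (λ e → f k <ᵇ f (shift k e)) (concat P)
    ≡⟨ count-cong (λ e → trans (strictMono-<ᵇ f-mono k (shift k e)) (<ᵇ-shift k e)) (concat P) ⟩
  count (k ≤ᵇ_) (concat P)
    ≡⟨ content k 1≤k k≤1+m ⟩
  suc m ∸ k
    ∎
  where open ≡-Reasoning

weight-relabelledPath : ∀ {f ks w} → StrictlyMonotone f → Reverse ks → Reverse w →
  length ks ≡ length w → ValidSteps 1 ks →
  RS w ≡ (relabel f (proj₁ (path ks)) , proj₂ (path ks)) → ∀ q → weight q ks ≡ q ^ inv w
weight-relabelledPath f-mono [] [] _ _ _ q = refl
weight-relabelledPath f-mono [] (w ∶ _ ∶ʳ x) len _ _ q = ⊥-elim (0≢1+n (trans len (length-∷ʳ w x)))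
weight-relabelledPath f-mono (ks ∶ _ ∶ʳ k) [] len _ _ q =
  ⊥-elim (0≢1+n (trans (sym len) (length-∷ʳ ks k)))
weight-relabelledPath {f} f-mono (ks ∶ rks ∶ʳ k) (w ∶ rw ∶ʳ x) len valid eq q
  with validSteps-∷ʳ 1 ks k valid
... | valid′ , 1≤k , k≤1+m = begin
  weight q (ks ∷ʳ k)                       ≡⟨ weightGo-∷ʳ q 1 ks k ⟩
  weight q ks * q ^ (suc m ∸ k)            ≡⟨ cong (_* q ^ (suc m ∸ k)) IH ⟩
  q ^ inv w * q ^ (suc m ∸ k)              ≡⟨ sym (^-distribˡ-+-* q (inv w) _) ⟩
  q ^ (inv w + (suc m ∸ k))                ≡⟨ cong (λ c → q ^ (inv w + c)) (sym newInversions) ⟩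
  q ^ (inv w + count (x <ᵇ_) w)            ≡⟨ cong (q ^_) (sym (inv-∷ʳ w x)) ⟩
  q ^ inv (w ∷ʳ x)                         ∎
  where
  open ≡-Reasoning
  m : ℕ
  m = length ks
  P : Tableau
  P = proj₁ (path ks)
  len′ : m ≡ length w
  len′ = suc-injective (trans (sym (length-∷ʳ ks k)) (trans len (length-∷ʳ w x)))
  determined : x ≡ f k × proj₁ (RS w) ≡ relabel (f ∘ shift k) P × proj₂ (RS w) ≡ proj₂ (path ks)
  determined = lastStep-determined f-mono
    (subst (λ j → Coherent (suc j) (RS w)) (sym len′) (coherent-RS rw))
    (coherent-path rks)
    (RS≡path-∷ʳ ks w len′ eq)
  IH : weight q ks ≡ q ^ inv w
  IH = weight-relabelledPath (f-mono ∘ shift-strictMono k) rks rw len′ valid′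
         (cong₂ _,_ (proj₁ (proj₂ determined)) (proj₂ (proj₂ determined))) q
  newInversions : count (x <ᵇ_) w ≡ suc m ∸ k
  newInversions = trans (cong (λ y → count (y <ᵇ_) w) (proj₁ determined))
    (inversions-lastLetter f-mono (contentUpTo-path rks valid′) 1≤k k≤1+m rw (proj₁ (proj₂ determined)))

lemma7 : (n : ℕ) (ks : List ℕ) → length ks ≡ n → ValidSteps 1 ks →
         (w : List ℕ) → IsPerm n w → RS w ≡ path ks →
         (q : ℕ) → weight q ks ≡ q ^ inv w
lemma7 n ks |ks|≡n valid w perm RSw≡path =
  weight-relabelledPath (λ p → p) (reverseView ks) (reverseView w) |ks|≡|w| valid
    (trans RSw≡path (cong (_, proj₂ (path ks)) (sym (relabel-id (proj₁ (path ks))))))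
  where
  |w|≡n : length w ≡ n
  |w|≡n = trans (↭-length perm) (trans (length-map suc (upTo n)) (length-upTo n))
  |ks|≡|w| : length ks ≡ length w
  |ks|≡|w| = trans |ks|≡n (sym |w|≡n)
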